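{- Work intuitionistically. For a topological space $X$ with interior operator $\mathrm{int}$ and weak closure operator $\mathrm{cl}$ (where $x\in\mathrm{cl}\,D$ iff every open set containing $x$ meets $D$ in an inhabited set), the following are equivalent: (1) $X$ is discrete; (2) $X$ is $T0$ and $\mathrm{int}\,\mathrm{cl}\,D=\mathrm{cl}\,D$ for every subset $D\subseteq X$.
   Context: $X$ is $T0$ if $\mathrm{cl}\{x\}=\mathrm{cl}\{y\}$ implies $x=y$ for all points $x,y$. A set $A\cap D$ is inhabited if it has an element. Discrete means every subset is open. -}

module Defs where

open import Level using (Level; _⊔_; suc; Lift)
open import Data.Unit using (⊤)
open import Data.Product using (Σ; ∃; _×_; _,_)
open import Relation.Unary using (Pred; _⊆_; _∩_; _≐_; _∈_)
open import Relation.Binary.PropositionalEquality using (_≡_)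

-- A topology on X (X : Set ℓ), with subsets of X given as Pred X ℓ.
-- Subsets are identified extensionally (as in set theory), hence the
-- field `open-ext`.
record Topology {ℓ : Level} (X : Set ℓ) (ℓ′ : Level) : Set (suc ℓ ⊔ suc ℓ′) where
  field
    IsOpen    : Pred X ℓ → Set ℓ′
    open-ext  : ∀ {A B : Pred X ℓ} → A ≐ B → IsOpen A → IsOpen B
    open-univ : IsOpen (λ _ → Lift ℓ ⊤)
    open-∩    : ∀ {A B : Pred X ℓ} → IsOpen A → IsOpen B → IsOpen (A ∩ B)
    open-⋃    : ∀ {I : Set ℓ} (F : I → Pred X ℓ) →
                (∀ i → IsOpen (F i)) → IsOpen (λ x → Σ I (λ i → F i x))

module _ {ℓ ℓ′ : Level} {X : Set ℓ} (T : Topology X ℓ′) where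
  open Topology T

  int : ∀ {ℓa} → Pred X ℓa → Pred X (suc ℓ ⊔ ℓ′ ⊔ ℓa)
  int A x = Σ (Pred X ℓ) (λ V → IsOpen V × V ⊆ A × V x)

  cl : ∀ {ℓd} → Pred X ℓd → Pred X (suc ℓ ⊔ ℓ′ ⊔ ℓd)
  cl D x = ∀ (V : Pred X ℓ) → IsOpen V → V x → ∃ (λ y → V y × D y)

  ⟅_⟆ : X → Pred X ℓ
  ⟅ x ⟆ y = y ≡ x

  IsT0 : Set (suc ℓ ⊔ ℓ′)
  IsT0 = ∀ (x y : X) → cl ⟅ x ⟆ ≐ cl ⟅ y ⟆ → x ≡ y

  IsDiscrete : Set (suc ℓ ⊔ ℓ′)
  IsDiscrete = ∀ (D : Pred X ℓ) → IsOpen D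

-- In a T0 space where closures of subsets are open, fix a point x and an open
-- V with x ∈ V ⊆ cl {x}. Every y ∈ V lies in cl {x}, and conversely x lies in
-- the open neighbourhood of y that is contained in cl {y}; so x and y
-- specialise each other, and T0 forces y = x. Hence V = {x}, all singletons
-- are open, and every subset is the union of its singletons. Conversely, in a
-- discrete space {x} is an open neighbourhood of x, which gives both T0 and
-- cl D ⊆ int (cl D) at once.
module Submission where

open import Defs hiding (⟅_⟆)
import Defs
open import Level using (Level)
open import Data.Product using (_×_; _,_; Σ; proj₁; proj₂)
open import Relation.Unary using (Pred; _≐_; _⊆_; _∈_)
open import Function.Bundles using (_⇔_; mk⇔)
open import Relation.Binary.PropositionalEquality using (_≡_; refl; sym; subst)

module _ {ℓ ℓ′ : Level} {X : Set ℓ} (T : Topology X ℓ′) where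
  open Topology T

  private
    ⟅_⟆ : X → Pred X ℓ
    ⟅_⟆ = Defs.⟅_⟆ T

  int⊆ : ∀ {ℓa} {A : Pred X ℓa} → int T A ⊆ A
  int⊆ (V , _ , V⊆A , x∈V) = V⊆A x∈V

  ⊆int⇒open : {D : Pred X ℓ} → D ⊆ int T D → IsOpen D
  ⊆int⇒open {D} D⊆intD = open-ext ⋃nbhd≐D (open-⋃ nbhd nbhd-open)
    where
    nbhd : Σ X D → Pred X ℓ
    nbhd (_ , x∈D) = proj₁ (D⊆intD x∈D)

    nbhd-open : ∀ i → IsOpen (nbhd i)
    nbhd-open (_ , x∈D) = proj₁ (proj₂ (D⊆intD x∈D))

    ⋃nbhd≐D : (λ y → Σ (Σ X D) λ i → nbhd i y) ≐ D
    ⋃nbhd≐D = (λ { ((_ , x∈D) , y∈V) → proj₁ (proj₂ (proj₂ (D⊆intD x∈D))) y∈V })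
            , (λ {y} y∈D → (y , y∈D) , proj₂ (proj₂ (proj₂ (D⊆intD y∈D))))

  x∈cl⟅x⟆ : ∀ x → x ∈ cl T ⟅ x ⟆
  x∈cl⟅x⟆ x _ _ x∈V = x , x∈V , refl

  cl⟅⟆⇒∈open : ∀ {x y} {V : Pred X ℓ} → y ∈ cl T ⟅ x ⟆ → IsOpen V → V y → V x
  cl⟅⟆⇒∈open y∈cl V-open y∈V with y∈cl _ V-open y∈V
  ... | _ , x∈V , refl = x∈V

  cl⟅⟆-trans : ∀ {x y z} → y ∈ cl T ⟅ x ⟆ → z ∈ cl T ⟅ y ⟆ → z ∈ cl T ⟅ x ⟆
  cl⟅⟆-trans y∈cl z∈cl V V-open z∈V = y∈cl V V-open (cl⟅⟆⇒∈open z∈cl V-open z∈V)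

  T0⇒cl⟅⟆-antisym : IsT0 T → ∀ {x y} → y ∈ cl T ⟅ x ⟆ → x ∈ cl T ⟅ y ⟆ → y ≡ x
  T0⇒cl⟅⟆-antisym t0 y∈cl x∈cl =
    t0 _ _ ((λ z∈cl → cl⟅⟆-trans y∈cl z∈cl) , (λ z∈cl → cl⟅⟆-trans x∈cl z∈cl))

  isolated⇒discrete : (∀ x → x ∈ int T ⟅ x ⟆) → IsDiscrete T
  isolated⇒discrete isolated D = ⊆int⇒open λ {x} x∈D →
    let (V , V-open , V⊆⟅x⟆ , x∈V) = isolated x
    in V , V-open , (λ y∈V → subst D (sym (V⊆⟅x⟆ y∈V)) x∈D) , x∈V

  T0∧int-cl⇒isolated : IsT0 T → (∀ (D : Pred X ℓ) → int T (cl T D) ≐ cl T D) →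
                        ∀ x → x ∈ int T ⟅ x ⟆
  T0∧int-cl⇒isolated t0 int-cl x = V x , V-open x , V⊆⟅x⟆ , x∈V x
    where
    nbhd : ∀ x → x ∈ int T (cl T ⟅ x ⟆)
    nbhd x = proj₂ (int-cl ⟅ x ⟆) (x∈cl⟅x⟆ x)

    V : X → Pred X ℓ
    V x = proj₁ (nbhd x)

    V-open : ∀ x → IsOpen (V x)
    V-open x = proj₁ (proj₂ (nbhd x))

    V⊆cl : ∀ x → V x ⊆ cl T ⟅ x ⟆
    V⊆cl x = proj₁ (proj₂ (proj₂ (nbhd x)))

    x∈V : ∀ x → V x x
    x∈V x = proj₂ (proj₂ (proj₂ (nbhd x)))

    V⊆⟅x⟆ : V x ⊆ ⟅ x ⟆
    V⊆⟅x⟆ {y} y∈V = T0⇒cl⟅⟆-antisym t0 (V⊆cl x y∈V)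
                      (V⊆cl y (cl⟅⟆⇒∈open (V⊆cl x y∈V) (V-open y) (x∈V y)))

  discrete⇒⊆int : IsDiscrete T → ∀ {ℓa} {A : Pred X ℓa} → A ⊆ int T A
  discrete⇒⊆int discrete {x = x} x∈A =
    ⟅ x ⟆ , discrete ⟅ x ⟆ , (λ { refl → x∈A }) , refl

  discrete⇒int≐ : IsDiscrete T → ∀ {ℓa} (A : Pred X ℓa) → int T A ≐ A
  discrete⇒int≐ discrete _ = int⊆ , discrete⇒⊆int discrete

  discrete⇒T0 : IsDiscrete T → IsT0 T
  discrete⇒T0 discrete x y (_ , cl⟅y⟆⊆cl⟅x⟆) =
    cl⟅⟆⇒∈open (cl⟅y⟆⊆cl⟅x⟆ (x∈cl⟅x⟆ y)) (discrete ⟅ y ⟆) refl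

proposition2p2 : ∀ {ℓ ℓ′ : Level} {X : Set ℓ} (T : Topology X ℓ′) →
    IsDiscrete T ⇔ (IsT0 T × (∀ (D : Pred X ℓ) → int T (cl T D) ≐ cl T D))
proposition2p2 T = mk⇔
  (λ discrete → discrete⇒T0 T discrete , λ D → discrete⇒int≐ T discrete (cl T D))
  (λ (t0 , int-cl) → isolated⇒discrete T (T0∧int-cl⇒isolated T t0 int-cl))
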